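{- For every positive integer $n$, \[ L_{n+1}^{(-1)}(x;y|q)=x\sum_{k=0}^n{n\brack k}_q\,k!_q\,[k+1]_y\,L_{n-k}^{(-1)}(x;y|q). \]
   Context: Notation: $[n]_q=\frac{1-q^n}{1-q}$, $[n]_y=\frac{1-y^n}{1-y}$, $n!_q=\prod_{i=1}^n[i]_q$, ${n\brack k}_q=\frac{n!_q}{k!_q(n-k)!_q}$. For $\alpha=-1$ the polynomials $L^{(-1)}_n(x;y;q)$ are defined by $L^{(-1)}_{ -1}=0$, $L^{(-1)}_0=1$ and, for $n\ge 0$, $L^{(-1)}_{n+1}(x;y;q)=\bigl(x-(y[n]_q+[n]_q)\bigr)L^{(-1)}_n(x;y;q)-y[n]_q[n-1]_q\,L^{(-1)}_{n-1}(x;y;q)$ (the general recurrence $L^{(\alpha)}_{n+1}=(x-(y[n+\alpha+1]_q+[n]_q))L^{(\alpha)}_n-y[n]_q[n+\alpha]_qL^{(\alpha)}_{n-1}$ at $\alpha=-1$), and $L^{(-1)}_n(x;y|q):=(-1)^nL^{(-1)}_n(-x;y;q)$. -}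

module Defs where

open import Data.Nat using (ℕ; zero; suc)
open import Algebra.Bundles using (CommutativeRing)

-- All quantities are evaluated in an arbitrary commutative ring R
-- (this covers the identity in ℤ[x,y,q] and every specialisation).
module _ {c ℓ} (R : CommutativeRing c ℓ) where
  open CommutativeRing R hiding (zero)

  pow : Carrier → ℕ → Carrier
  pow a zero    = 1#
  pow a (suc n) = pow a n * a

  qint : Carrier → ℕ → Carrier
  qint q zero    = 0#
  qint q (suc n) = 1# + q * qint q n

  qfact : Carrier → ℕ → Carrier
  qfact q zero    = 1#
  qfact q (suc n) = qfact q n * qint q (suc n)

  -- Gaussian binomial [n k]_q via q-Pascal rule (0 for k > n)
  qbinom : Carrier → ℕ → ℕ → Carrier
  qbinom q n       zero    = 1#
  qbinom q zero    (suc k) = 0#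
  qbinom q (suc n) (suc k) = qbinom q n k + pow q (suc k) * qbinom q n (suc k)

  -- L^{(-1)}_n(x;y;q) via the three-term recurrence, L_{-1} = 0, L_0 = 1
  L : Carrier → Carrier → Carrier → ℕ → Carrier
  L x y q zero          = 1#
  L x y q (suc zero)    = (x - (y * qint q 0 + qint q 0)) * 1#
  L x y q (suc (suc n)) =
    (x - (y * qint q (suc n) + qint q (suc n))) * L x y q (suc n)
    - y * qint q (suc n) * qint q n * L x y q n

  -- L^{(-1)}_n(x;y|q) = (-1)^n L^{(-1)}_n(-x;y;q)
  Lbar : Carrier → Carrier → Carrier → ℕ → Carrier
  Lbar x y q n = pow (- 1#) n * L (- x) y q n

  sumTo : ℕ → (ℕ → Carrier) → Carrier
  sumTo zero    f = f 0
  sumTo (suc n) f = sumTo n f + f (suc n)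

-- The identity only uses the three-term recurrence of P n := L_n(x;y|q),
--   P 1 = x P 0,   P (n+2) = (x + y[n+1]_q + [n+1]_q) P (n+1) - y [n+1]_q [n]_q P n,
-- so it is proved for an arbitrary sequence P obeying it (module Convolution).
-- The coefficients F n k := [n k]_q k!_q are q-falling factorials: by the
-- absorption identity [n+1]_q [n k]_q = [k+1]_q [n+1 k+1]_q they satisfy
-- F (n+1) (k+1) = [n+1]_q F n k, so peeling off the k = 0 term of the sums
--   T n = Σ_k F n k P (n-k)   and   S n = Σ_k F n k [k+1]_y P (n-k)
-- gives T (n+1) = P (n+1) + [n+1]_q T n and S (n+1) = P (n+1) + [n+1]_q (T n + y S n).
-- Induction on n with the recurrence then yields first x T n = P (n+1) - y [n]_q P n
-- and from it x S n = P (n+1).  Finally L_n(x;y|q) = (-1)^n L_n(-x;y;q) is shown to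
-- satisfy the recurrence, and the theorem follows (for every n, including n = 0).  Recurrences are written
-- without subtraction, so that the polynomial identities in each step lie in the
-- semiring fragment handled by the natural-coefficient solver; the extra term is
-- removed at the end of an induction step by additive cancellation.
module Submission where

open import Defs
open import Data.Nat using (ℕ; zero; suc; _≤_; _∸_)
open import Data.Nat.Properties using (_≟_)
open import Data.Maybe using (Maybe; just; nothing)
open import Relation.Nullary using (yes; no)
import Relation.Binary.PropositionalEquality as ≡
open import Algebra.Bundles using (CommutativeRing)
import Algebra.Properties.Semiring.Mult as SemiringMult
import Algebra.Solver.Ring.NaturalCoefficients as NaturalCoefficientSolver
import Relation.Binary.Reasoning.Setoid as SetoidReasoning

module QLaguerre {r ℓ} (R : CommutativeRing r ℓ) where
  open CommutativeRing R hiding (zero)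
  open SetoidReasoning setoid

  open SemiringMult semiring using (_×_)
  open import Algebra.Properties.Group +-group using (∙-cancelʳ; //-rightDividesˡ; ⁻¹-involutive)
  open import Algebra.Properties.AbelianGroup +-abelianGroup using (⁻¹-∙-comm)
  open import Algebra.Properties.Ring ring using (-1*x≈-x)

  equal-numerals : ∀ m n → Maybe (m × 1# ≈ n × 1#)
  equal-numerals m n with m ≟ n
  ... | yes ≡.refl = just refl
  ... | no _     = nothing

  open NaturalCoefficientSolver commutativeSemiring equal-numerals
    using (solve; _:=_; _:+_; _:*_; con)

  sumTo-cong : ∀ n {f g : ℕ → Carrier} → (∀ k → f k ≈ g k) → sumTo R n f ≈ sumTo R n g
  sumTo-cong zero    f≈g = f≈g 0
  sumTo-cong (suc n) f≈g = +-cong (sumTo-cong n f≈g) (f≈g (suc n))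

  sumTo-peel : ∀ n (f : ℕ → Carrier) → sumTo R (suc n) f ≈ f 0 + sumTo R n (λ k → f (suc k))
  sumTo-peel zero    f = refl
  sumTo-peel (suc n) f = trans (+-cong (sumTo-peel n f) refl) (+-assoc _ _ _)

  sumTo-+ : ∀ n (f g : ℕ → Carrier) → sumTo R n (λ k → f k + g k) ≈ sumTo R n f + sumTo R n g
  sumTo-+ zero    f g = refl
  sumTo-+ (suc n) f g = trans (+-cong (sumTo-+ n f g) refl)
    (solve 4 (λ a b c d → (a :+ b) :+ (c :+ d) := (a :+ c) :+ (b :+ d)) refl _ _ _ _)

  sumTo-*ˡ : ∀ n a (f : ℕ → Carrier) → sumTo R n (λ k → a * f k) ≈ a * sumTo R n f
  sumTo-*ˡ zero    a f = refl
  sumTo-*ˡ (suc n) a f = trans (+-cong (sumTo-*ˡ n a f) refl) (sym (distribˡ a _ _))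

  module _ (q : Carrier) where
    private
      [_] : ℕ → Carrier
      [ n ] = qint R q n

    qbinom-one : ∀ n → qbinom R q n 1 ≈ [ n ]
    qbinom-one zero    = refl
    qbinom-one (suc n) = begin
      1# + (1# * q) * qbinom R q n 1  ≈⟨ +-cong refl (*-cong (*-identityˡ q) (qbinom-one n)) ⟩
      1# + q * [ n ]                  ∎

    qbinom-absorb : ∀ n k → [ suc n ] * qbinom R q n k ≈ [ suc k ] * qbinom R q (suc n) (suc k)
    qbinom-absorb n zero = begin
      [ suc n ] * 1#                  ≈⟨ *-identityʳ _ ⟩
      [ suc n ]                       ≈⟨ sym (qbinom-one (suc n)) ⟩
      qbinom R q (suc n) 1            ≈⟨ solve 2 (λ q B → B := (con 1 :+ q :* con 0) :* B) refl q _ ⟩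
      [ 1 ] * qbinom R q (suc n) 1    ∎
    qbinom-absorb zero (suc k) =
      solve 3 (λ q a p → (con 1 :+ q :* con 0) :* con 0 := a :* (con 0 :+ p :* con 0))
        refl q [ suc (suc k) ] (pow R q (suc (suc k)))
    qbinom-absorb (suc m) (suc j) = begin
      (1# + q * a) * (b₀ + p * b₁)
        ≈⟨ solve 5 (λ q a b₀ b₁ p → (con 1 :+ q :* a) :* (b₀ :+ p :* b₁)
                                  := (b₀ :+ p :* b₁) :+ q :* (a :* b₀) :+ p :* q :* (a :* b₁))
                   refl q a b₀ b₁ p ⟩
      (b₀ + p * b₁) + q * (a * b₀) + p * q * (a * b₁)
        ≈⟨ +-cong (+-cong refl (*-cong refl (qbinom-absorb m j)))
                  (*-cong refl (qbinom-absorb m (suc j))) ⟩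
      (b₀ + p * b₁) + q * (c * B₁) + p * q * ((1# + q * c) * B₂)
        ≈⟨ solve 6 (λ q c b₀ b₁ p B₂ →
                      (b₀ :+ p :* b₁) :+ q :* (c :* (b₀ :+ p :* b₁)) :+ p :* q :* ((con 1 :+ q :* c) :* B₂)
                   := (con 1 :+ q :* c) :* ((b₀ :+ p :* b₁) :+ p :* q :* B₂))
                   refl q c b₀ b₁ p B₂ ⟩
      (1# + q * c) * (B₁ + p * q * B₂) ∎
      where
      a c b₀ b₁ p B₁ B₂ : Carrier
      a = [ suc m ]
      c = [ suc j ]
      b₀ = qbinom R q m j
      b₁ = qbinom R q m (suc j)
      p = pow R q (suc j)
      B₁ = qbinom R q (suc m) (suc j)
      B₂ = qbinom R q (suc m) (suc (suc j))

    -- The q-falling factorial [n k]_q k!_q = [n]_q [n-1]_q ⋯ [n-k+1]_q.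
    qfalling : ℕ → ℕ → Carrier
    qfalling n k = qbinom R q n k * qfact R q k

    qfalling-suc : ∀ n k → qfalling (suc n) (suc k) ≈ [ suc n ] * qfalling n k
    qfalling-suc n k = begin
      qbinom R q (suc n) (suc k) * (qfact R q k * [ suc k ])
        ≈⟨ solve 3 (λ B f c → B :* (f :* c) := (c :* B) :* f) refl _ (qfact R q k) [ suc k ] ⟩
      ([ suc k ] * qbinom R q (suc n) (suc k)) * qfact R q k
        ≈⟨ *-cong (sym (qbinom-absorb n k)) refl ⟩
      ([ suc n ] * qbinom R q n k) * qfact R q k
        ≈⟨ *-assoc _ _ _ ⟩
      [ suc n ] * qfalling n k ∎

  module Convolution (x y q : Carrier) (P : ℕ → Carrier)
    (P-one : P 1 ≈ x * P 0)
    (P-rec : ∀ n → P (suc (suc n)) + y * qint R q (suc n) * qint R q n * P n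
                   ≈ (x + (y * qint R q (suc n) + qint R q (suc n))) * P (suc n))
    where
    private
      [_] : ℕ → Carrier
      [ n ] = qint R q n

      F : ℕ → ℕ → Carrier
      F = qfalling q

    T S : ℕ → Carrier
    T n = sumTo R n (λ k → F n k * P (n ∸ k))
    S n = sumTo R n (λ k → F n k * qint R y (suc k) * P (n ∸ k))

    T-peel : ∀ n → T (suc n) ≈ P (suc n) + [ suc n ] * T n
    T-peel n = begin
      T (suc n)
        ≈⟨ sumTo-peel n _ ⟩
      (1# * 1#) * P (suc n) + sumTo R n (λ k → F (suc n) (suc k) * P (n ∸ k))
        ≈⟨ +-cong (solve 1 (λ p → (con 1 :* con 1) :* p := p) refl _)
                  (sumTo-cong n (λ k → trans (*-cong (qfalling-suc q n k) refl) (*-assoc _ _ _))) ⟩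
      P (suc n) + sumTo R n (λ k → [ suc n ] * (F n k * P (n ∸ k)))
        ≈⟨ +-cong refl (sumTo-*ˡ n _ _) ⟩
      P (suc n) + [ suc n ] * T n ∎

    -- Here [k+2]_y = 1 + y [k+1]_y splits each shifted term into a T-term and an S-term.
    S-peel : ∀ n → S (suc n) ≈ P (suc n) + [ suc n ] * (T n + y * S n)
    S-peel n = begin
      S (suc n)
        ≈⟨ sumTo-peel n _ ⟩
      (1# * 1#) * (1# + y * 0#) * P (suc n)
        + sumTo R n (λ k → F (suc n) (suc k) * qint R y (suc (suc k)) * P (n ∸ k))
        ≈⟨ +-cong (solve 2 (λ y p → (con 1 :* con 1) :* (con 1 :+ y :* con 0) :* p := p) refl y _)
                  (sumTo-cong n shifted-term) ⟩
      P (suc n) + sumTo R n (λ k → [ suc n ] * (F n k * P (n ∸ k) + y * (F n k * qint R y (suc k) * P (n ∸ k))))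
        ≈⟨ +-cong refl (trans (sumTo-*ˡ n _ _)
                              (*-cong refl (trans (sumTo-+ n _ _) (+-cong refl (sumTo-*ˡ n y _))))) ⟩
      P (suc n) + [ suc n ] * (T n + y * S n) ∎
      where
      shifted-term : ∀ k → F (suc n) (suc k) * qint R y (suc (suc k)) * P (n ∸ k)
                         ≈ [ suc n ] * (F n k * P (n ∸ k) + y * (F n k * qint R y (suc k) * P (n ∸ k)))
      shifted-term k = begin
        F (suc n) (suc k) * (1# + y * qint R y (suc k)) * P (n ∸ k)
          ≈⟨ *-cong (*-cong (qfalling-suc q n k) refl) refl ⟩
        [ suc n ] * F n k * (1# + y * qint R y (suc k)) * P (n ∸ k)
          ≈⟨ solve 5 (λ a f y c p → a :* f :* (con 1 :+ y :* c) :* p := a :* (f :* p :+ y :* (f :* c :* p)))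
                     refl [ suc n ] (F n k) y (qint R y (suc k)) (P (n ∸ k)) ⟩
        [ suc n ] * (F n k * P (n ∸ k) + y * (F n k * qint R y (suc k) * P (n ∸ k))) ∎

    -- x T n = P (n+1) - y [n]_q P n, stated without subtraction.  The inductive step
    -- adds y [n+1]_q [n]_q P n to both sides so that the recurrence applies, then cancels it.
    x-T : ∀ n → x * T n + y * [ n ] * P n ≈ P (suc n)
    x-T zero = begin
      x * ((1# * 1#) * P 0) + y * 0# * P 0
        ≈⟨ solve 3 (λ x y p → x :* ((con 1 :* con 1) :* p) :+ y :* con 0 :* p := x :* p) refl x y (P 0) ⟩
      x * P 0 ≈⟨ sym P-one ⟩
      P 1     ∎
    x-T (suc n) = ∙-cancelʳ G _ _ (begin
      x * T (suc n) + y * a * P₁ + G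
        ≈⟨ +-cong (+-cong (*-cong refl (T-peel n)) refl) refl ⟩
      x * (P₁ + a * T n) + y * a * P₁ + G
        ≈⟨ solve 7 (λ x y a b P₀ P₁ t → x :* (P₁ :+ a :* t) :+ y :* a :* P₁ :+ y :* a :* b :* P₀
                                       := x :* P₁ :+ a :* (x :* t :+ y :* b :* P₀) :+ y :* a :* P₁)
                   refl x y a [ n ] (P n) P₁ (T n) ⟩
      x * P₁ + a * (x * T n + y * [ n ] * P n) + y * a * P₁
        ≈⟨ +-cong (+-cong refl (*-cong refl (x-T n))) refl ⟩
      x * P₁ + a * P₁ + y * a * P₁
        ≈⟨ solve 4 (λ x y a P₁ → x :* P₁ :+ a :* P₁ :+ y :* a :* P₁ := (x :+ (y :* a :+ a)) :* P₁)
                   refl x y a P₁ ⟩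
      (x + (y * a + a)) * P₁
        ≈⟨ sym (P-rec n) ⟩
      P (suc (suc n)) + G ∎)
      where
      a P₁ G : Carrier
      a = [ suc n ]
      P₁ = P (suc n)
      G = y * a * [ n ] * P n

    x-S : ∀ n → x * S n ≈ P (suc n)
    x-S zero = begin
      x * ((1# * 1#) * (1# + y * 0#) * P 0)
        ≈⟨ solve 3 (λ x y p → x :* ((con 1 :* con 1) :* (con 1 :+ y :* con 0) :* p) := x :* p) refl x y (P 0) ⟩
      x * P 0 ≈⟨ sym P-one ⟩
      P 1     ∎
    x-S (suc n) = ∙-cancelʳ G _ _ (begin
      x * S (suc n) + G
        ≈⟨ +-cong (*-cong refl (S-peel n)) refl ⟩
      x * (P₁ + a * (T n + y * S n)) + G
        ≈⟨ solve 8 (λ x y a b P₀ P₁ t s → x :* (P₁ :+ a :* (t :+ y :* s)) :+ y :* a :* b :* P₀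
                                         := x :* P₁ :+ a :* (x :* t :+ y :* b :* P₀) :+ a :* y :* (x :* s))
                   refl x y a [ n ] (P n) P₁ (T n) (S n) ⟩
      x * P₁ + a * (x * T n + y * [ n ] * P n) + a * y * (x * S n)
        ≈⟨ +-cong (+-cong refl (*-cong refl (x-T n))) (*-cong refl (x-S n)) ⟩
      x * P₁ + a * P₁ + a * y * P₁
        ≈⟨ solve 4 (λ x y a P₁ → x :* P₁ :+ a :* P₁ :+ a :* y :* P₁ := (x :+ (y :* a :+ a)) :* P₁)
                   refl x y a P₁ ⟩
      (x + (y * a + a)) * P₁
        ≈⟨ sym (P-rec n) ⟩
      P (suc (suc n)) + G ∎)
      where
      a P₁ G : Carrier
      a = [ suc n ]
      P₁ = P (suc n)
      G = y * a * [ n ] * P n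

  ν : Carrier
  ν = - 1#

  ν*ν≈1 : ν * ν ≈ 1#
  ν*ν≈1 = trans (-1*x≈-x ν) (⁻¹-involutive 1#)

  sign-period : ∀ n → pow R ν (suc (suc n)) ≈ pow R ν n
  sign-period n = trans (*-assoc _ _ _) (trans (*-cong refl ν*ν≈1) (*-identityʳ _))

  -- -a - b = (-1)(a + b): turns the subtracted leading coefficient into a sign.
  neg-sum : ∀ a b → (- a) - b ≈ ν * (a + b)
  neg-sum a b = trans (⁻¹-∙-comm a b) (sym (-1*x≈-x (a + b)))

  module _ (x y q : Carrier) where
    private
      [_] : ℕ → Carrier
      [ n ] = qint R q n

    Lbar-one : Lbar R x y q 1 ≈ x * Lbar R x y q 0
    Lbar-one = begin
      (1# * ν) * (((- x) - w) * 1#)  ≈⟨ *-cong refl (*-cong (neg-sum x w) refl) ⟩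
      (1# * ν) * ((ν * (x + w)) * 1#)
        ≈⟨ solve 3 (λ ν x w → (con 1 :* ν) :* ((ν :* (x :+ w)) :* con 1) := (ν :* ν) :* (x :+ w)) refl ν x w ⟩
      (ν * ν) * (x + w)              ≈⟨ *-cong ν*ν≈1 refl ⟩
      1# * (x + (y * 0# + 0#))
        ≈⟨ solve 2 (λ x y → con 1 :* (x :+ (y :* con 0 :+ con 0)) := x :* (con 1 :* con 1)) refl x y ⟩
      x * (1# * 1#)                  ∎
      where
      w : Carrier
      w = y * 0# + 0#

    -- The recurrence of L_n(-x;y;q) read without subtraction is
    --   L_{n+2} + G L_n = -(x + c) L_{n+1},
    -- and the sign (-1)^{n+1} of L_{n+1}(x;y|q) absorbs the minus sign.
    Lbar-rec : ∀ n → Lbar R x y q (suc (suc n)) + y * [ suc n ] * [ n ] * Lbar R x y q n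
                     ≈ (x + (y * [ suc n ] + [ suc n ])) * Lbar R x y q (suc n)
    Lbar-rec n = begin
      pow R ν (suc (suc n)) * L₂ + G * (s * L₀)  ≈⟨ +-cong (*-cong (sign-period n) refl) refl ⟩
      s * L₂ + G * (s * L₀)
        ≈⟨ solve 4 (λ s L₂ G L₀ → s :* L₂ :+ G :* (s :* L₀) := s :* (L₂ :+ G :* L₀)) refl s L₂ G L₀ ⟩
      s * (L₂ + G * L₀)                          ≈⟨ *-cong refl (//-rightDividesˡ (G * L₀) _) ⟩
      s * (((- x) - c) * L₁)                     ≈⟨ *-cong refl (*-cong (neg-sum x c) refl) ⟩
      s * ((ν * (x + c)) * L₁)
        ≈⟨ solve 5 (λ s ν x c L₁ → s :* ((ν :* (x :+ c)) :* L₁) := (x :+ c) :* ((s :* ν) :* L₁))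
                   refl s ν x c L₁ ⟩
      (x + c) * Lbar R x y q (suc n)             ∎
      where
      s c G L₀ L₁ L₂ : Carrier
      s = pow R ν n
      c = y * [ suc n ] + [ suc n ]
      G = y * [ suc n ] * [ n ]
      L₀ = L R (- x) y q n
      L₁ = L R (- x) y q (suc n)
      L₂ = L R (- x) y q (suc (suc n))

-- The sum on the right is, by definition, Convolution.S n for P = L(x;y|q); the
-- identity holds for every n.
proposition1 : ∀ {c ℓ} (R : CommutativeRing c ℓ) → let open CommutativeRing R in
    ∀ (x y q : Carrier) (n : ℕ) → 1 ≤ n →
      Lbar R x y q (suc n) ≈
        x * sumTo R n (λ k → qbinom R q n k * qfact R q k * qint R y (suc k) * Lbar R x y q (n ∸ k))
proposition1 R x y q n _ = sym (x-S n)
  where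
  open CommutativeRing R using (sym)
  open QLaguerre R using (module Convolution; Lbar-one; Lbar-rec)
  open Convolution x y q (Lbar R x y q) (Lbar-one x y q) (Lbar-rec x y q) using (x-S)
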